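{- For $t \in \Omega(\log n) \cap o(n)$, the classes $\mathrm{ACA}(t)$ and $\mathrm{REG}$ are incomparable (neither is contained in the other).
   Context: A cellular automaton (CA) is $C=(Q,\delta,\Sigma)$ with finite state set $Q$, local rule $\delta\colon Q^3\to Q$, input alphabet $\Sigma\subseteq Q$, and an inactive state $q\in Q\setminus\Sigma$ with $\delta(z_1,z_2,z_3)=q$ iff $z_2=q$; the global map is $\Delta(c)(z)=\delta(c(z-1),c(z),c(z+1))$ on $Q^{\mathbb{Z}}$. For input $w\in\Sigma^+$ the initial configuration has $c_0(i)=w(i)$ for $0\le i<|w|$ and $q$ elsewhere. An ACA additionally has a nonempty set $A\subseteq Q\setminus\{q\}$ of accept states and accepts $w$ if some $\Delta^\tau(c_0)$ has all cells in $A\cup\{q\}$; the least such $\tau$ is the acceptance time. $\mathrm{ACA}(t)$ is the class of languages $L(C)$ of ACAs accepting every $w\in L(C)$ within $t(|w|)$ steps. Languages never contain the empty word. $\mathrm{REG}$ is the class of regular languages (not containing the empty word). -}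

module Defs where

open import Level using (0ℓ) renaming (suc to lsuc)
open import Data.Nat using (ℕ; zero; suc; _*_; _≤_)
open import Data.Nat.Logarithm using (⌊log₂_⌋)
open import Data.Integer as ℤ using (ℤ; +_; -[1+_])
open import Data.Fin using (Fin)
open import Data.Bool using (Bool; true; false)
open import Data.List using (List; []; _∷_; length)
open import Data.Sum using (_⊎_)
open import Data.Maybe using (Maybe; just; nothing)
open import Data.Product using (Σ; ∃; ∃-syntax; _×_; _,_)
open import Relation.Nullary using (¬_)
open import Relation.Binary.PropositionalEquality using (_≡_; _≢_)
open import Function.Bundles using (_⇔_)

-- Words and languages over the finite alphabet Fin k.
-- A language is a predicate on words; languages never contain [].

Language : ℕ → Set₁
Language k = List (Fin k) → Set

_≐_ : ∀ {k} → Language k → Language k → Set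
L ≐ M = ∀ w → L w ⇔ M w

-- The state set is Q = Fin nQ; Σ ⊆ Q is realised by an injective
-- embedding inp : Fin k → Fin nQ.  The accept set A ⊆ Q ∖ {q} is given
-- by its characteristic function acc.

record ACA (k : ℕ) : Set where
  field
    nQ      : ℕ
    δ       : Fin nQ → Fin nQ → Fin nQ → Fin nQ
    inp     : Fin k → Fin nQ
    inp-inj : ∀ a b → inp a ≡ inp b → a ≡ b
    q       : Fin nQ
    q∉Σ     : ∀ a → inp a ≢ q
    δ-q     : ∀ z₁ z₂ z₃ → (δ z₁ z₂ z₃ ≡ q) ⇔ (z₂ ≡ q)
    acc     : Fin nQ → Bool
    acc-ne  : ∃[ a ] (acc a ≡ true)
    q∉A     : acc q ≡ false

module _ {k : ℕ} (C : ACA k) where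
  open ACA C

  Config : Set
  Config = ℤ → Fin nQ

  Δ : Config → Config
  Δ c z = δ (c (ℤ.pred z)) (c z) (c (ℤ.suc z))

  Δ^ : ℕ → Config → Config
  Δ^ zero    c = c
  Δ^ (suc n) c = Δ (Δ^ n c)

  private
    nth : List (Fin k) → ℕ → Maybe (Fin k)
    nth []      _       = nothing
    nth (a ∷ w) zero    = just a
    nth (a ∷ w) (suc i) = nth w i

    cell : Maybe (Fin k) → Fin nQ
    cell (just a) = inp a
    cell nothing  = q

  initial : List (Fin k) → Config
  initial w (+ i)    = cell (nth w i)
  initial w -[1+ _ ] = q

  AllAccOrQ : Config → Set
  AllAccOrQ c = ∀ z → (acc (c z) ≡ true) ⊎ (c z ≡ q)

  AcceptsAt : List (Fin k) → ℕ → Set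
  AcceptsAt w τ = AllAccOrQ (Δ^ τ (initial w))

  LangACA : Language k
  LangACA w = (w ≢ []) × ∃[ τ ] AcceptsAt w τ

  AcceptsWithin : ℕ → List (Fin k) → Set
  AcceptsWithin T w = ∃[ τ ] (τ ≤ T × AcceptsAt w τ)

InACA : (ℕ → ℕ) → ∀ {k} → Language k → Set
InACA t {k} L = Σ (ACA k) λ C →
  (L ≐ LangACA C) × (∀ w → LangACA C w → AcceptsWithin C (t (length w)) w)

record DFA (k : ℕ) : Set where
  field
    nS    : ℕ
    start : Fin nS
    step  : Fin nS → Fin k → Fin nS
    final : Fin nS → Bool

run : ∀ {k} (D : DFA k) → Fin (DFA.nS D) → List (Fin k) → Fin (DFA.nS D)
run D s []      = s
run D s (a ∷ w) = run D (DFA.step D s a) w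

LangDFA : ∀ {k} → DFA k → Language k
LangDFA D w = (w ≢ []) × (DFA.final D (run D (DFA.start D) w) ≡ true)

InREG : ∀ {k} → Language k → Set
InREG {k} L = Σ (DFA k) λ D → L ≐ LangDFA D

-- t ∈ Ω(log n): ∃ c N. ∀ n ≥ N. log₂ n ≤ c · t(n)
-- (base of log and floor irrelevant up to the constant c)
IsΩlog : (ℕ → ℕ) → Set
IsΩlog t = ∃[ c ] ∃[ N ] (∀ n → N ≤ n → ⌊log₂ n ⌋ ≤ c * t n)

Is-o-n : (ℕ → ℕ) → Set
Is-o-n t = ∀ c → ∃[ N ] (∀ n → N ≤ n → c * t n ≤ n)

ACA⊆REG : (ℕ → ℕ) → Set₁
ACA⊆REG t = ∀ k (L : Language k) → InACA t L → InREG L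

REG⊆ACA : (ℕ → ℕ) → Set₁
REG⊆ACA t = ∀ k (L : Language k) → InREG L → InACA t L

module Submission where

-- Both inclusions fail because an ACA running for τ steps only sees a window of radius τ.
--
-- REG ⊄ ACA(t) for t ∈ o(n): the odd-length unary words are regular. If an ACA accepted aⁿ
-- (n odd) after τ ≤ t(n) steps with 2τ < n, then every cell of aⁿ⁺¹ sees in its window of
-- radius τ exactly what some cell of aⁿ sees (the same cell for the left part, the cell one
-- step to the left for the right part), so aⁿ⁺¹ would be accepted at time τ as well.
--
-- ACA(t) ⊄ REG for t ∈ Ω(log n), with log₂ n ≤ c·t(n) for n ≥ N: for B = 2^(c+N+1) an ACA
-- accepts at time τ exactly the words #w₀#w₁#⋯#w_{m−1}# whose blocks have length τ − 1 and
-- spell the base-B numerals 0, 1, …, m − 1 = B^(τ−1) − 1, each digit tagged with its incoming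
-- carry: after τ steps every cell knows its neighbours and the letters τ cells away, which is
-- all that is needed to check the numbering. Such a word has length n > B^(τ−1), so
-- c·t(n) ≥ log₂ n ≥ (c+N+1)(τ−1), which forces τ ≤ t(n). Replacing the first block of the word
-- with block length b by that of the word with block length a ≠ b gives a rejected word, so
-- a DFA for the language would have to reach pairwise different states after these blocks.

open import Defs
open import Data.Nat as ℕ using (ℕ; zero; suc; _≤_; _<_; z≤n; s≤s; _+_; _*_; _^_; _∸_; _≡ᵇ_; _<?_; _≤?_)
open import Data.Nat.Properties
open import Data.Nat.DivMod using (_/_; _%_; m≡m%n+[m/n]*n; m%n<n; +-distrib-/-∣ʳ; m<n⇒m/n≡0; m*n/n≡m; [m+kn]%n≡m%n; m<n⇒m%n≡m)
open import Data.Nat.Divisibility using (divides)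
open import Data.Nat.Logarithm using (⌊log₂_⌋; ⌊log₂⌋-mono-≤; ⌊log₂[2^n]⌋≡n)
import Data.Nat.Tactic.RingSolver as ℕ-Ring
open import Data.Integer as ℤ using (ℤ; +_; -[1+_]; _⊖_)
import Data.Integer.Properties as ℤ
import Data.Integer.Tactic.RingSolver as ℤ-Ring
open import Data.Fin using (Fin; zero; suc; toℕ; fromℕ<; remQuot; combine; opposite)
open import Data.Fin.Properties using (remQuot-combine; toℕ-fromℕ<; *↔×; 2↔Bool; opposite-involutive; pigeonhole)
open import Data.Bool using (Bool; true; false; _∧_; not; if_then_else_; T)
open import Data.List using (List; []; _∷_; length; map; take; drop; _++_; applyUpTo; replicate)
open import Data.List.Properties using (length-map; length-applyUpTo; length-replicate; length-take; map-++; take-map; drop-map; take++drop≡id)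
open import Data.Maybe using (Maybe; just; nothing; maybe; is-nothing)
import Data.Maybe as Maybe
open import Data.Maybe.Properties using (just-injective)
open import Data.Product using (∃-syntax; _×_; _,_; proj₁; proj₂)
open import Data.Product.Function.NonDependent.Propositional using (_×-↔_)
open import Data.Sum using (_⊎_; inj₁; inj₂)
open import Data.Empty using (⊥-elim)
open import Relation.Nullary using (¬_; yes; no)
open import Relation.Binary.Definitions using (tri<; tri≈; tri>)
open import Relation.Binary.PropositionalEquality
open import Function.Base using (id)
open import Function.Bundles using (_↔_; mk↔ₛ′; Inverse; _⇔_; mk⇔; Equivalence)
open import Function.Properties.Inverse using (↔-refl; ↔-trans; ↔-sym)

private variable
  A C : Set

cong₃ : ∀ {A B D E : Set} (f : A → B → D → E) {a a′ b b′ d d′} →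
        a ≡ a′ → b ≡ b′ → d ≡ d′ → f a b d ≡ f a′ b′ d′
cong₃ f refl refl refl = refl

infixl 5 _‼_

_‼_ : List A → ℕ → Maybe A
[] ‼ _ = nothing
(x ∷ xs) ‼ zero = just x
(x ∷ xs) ‼ suc i = xs ‼ i

back : List A → ℕ → ℕ → Maybe A
back xs zero i = xs ‼ i
back xs (suc d) zero = nothing
back xs (suc d) (suc i) = back xs d i

‼-just⇒< : ∀ (xs : List A) i {x} → xs ‼ i ≡ just x → i < length xs
‼-just⇒< (_ ∷ xs) zero _ = s≤s z≤n
‼-just⇒< (_ ∷ xs) (suc i) eq = s≤s (‼-just⇒< xs i eq)

<⇒‼-just : ∀ (xs : List A) i → i < length xs → ∃[ x ] (xs ‼ i ≡ just x)
<⇒‼-just (x ∷ xs) zero _ = x , refl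
<⇒‼-just (_ ∷ xs) (suc i) (s≤s i<n) = <⇒‼-just xs i i<n

≥⇒‼-nothing : ∀ (xs : List A) i → length xs ≤ i → xs ‼ i ≡ nothing
≥⇒‼-nothing [] i _ = refl
≥⇒‼-nothing (_ ∷ xs) (suc i) (s≤s n≤i) = ≥⇒‼-nothing xs i n≤i

≢[]⇒‼0 : ∀ (xs : List A) → xs ≢ [] → ∃[ x ] (xs ‼ 0 ≡ just x)
≢[]⇒‼0 [] xs≢[] = ⊥-elim (xs≢[] refl)
≢[]⇒‼0 (x ∷ xs) _ = x , refl

‼-nothing-+ : ∀ (xs : List A) i d → xs ‼ i ≡ nothing → xs ‼ (i + d) ≡ nothing
‼-nothing-+ [] i d _ = refl
‼-nothing-+ (_ ∷ xs) (suc i) d eq = ‼-nothing-+ xs i d eq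

‼-map : ∀ (f : A → C) xs i → map f xs ‼ i ≡ Maybe.map f (xs ‼ i)
‼-map f [] i = refl
‼-map f (x ∷ xs) zero = refl
‼-map f (x ∷ xs) (suc i) = ‼-map f xs i

‼-map-just : ∀ (f : A → C) xs i {y} → map f xs ‼ i ≡ just y → ∃[ x ] (xs ‼ i ≡ just x × f x ≡ y)
‼-map-just f (x ∷ xs) zero refl = x , refl , refl
‼-map-just f (x ∷ xs) (suc i) eq = ‼-map-just f xs i eq

back-map : ∀ (f : A → C) xs d i → back (map f xs) d i ≡ Maybe.map f (back xs d i)
back-map f xs zero i = ‼-map f xs i
back-map f xs (suc d) zero = refl
back-map f xs (suc d) (suc i) = back-map f xs d i

back-< : ∀ (xs : List A) {d i} → i < d → back xs d i ≡ nothing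
back-< xs {suc d} {zero} _ = refl
back-< xs {suc d} {suc i} (s≤s i<d) = back-< xs i<d

back-+ : ∀ (xs : List A) d i → back xs d (d + i) ≡ xs ‼ i
back-+ xs zero i = refl
back-+ xs (suc d) i = back-+ xs d i

‼-++ˡ : ∀ (xs ys : List A) i → i < length xs → (xs ++ ys) ‼ i ≡ xs ‼ i
‼-++ˡ (x ∷ xs) ys zero _ = refl
‼-++ˡ (x ∷ xs) ys (suc i) (s≤s i<n) = ‼-++ˡ xs ys i i<n

‼-++ʳ : ∀ (xs ys : List A) i → (xs ++ ys) ‼ (length xs + i) ≡ ys ‼ i
‼-++ʳ [] ys i = refl
‼-++ʳ (x ∷ xs) ys i = ‼-++ʳ xs ys i

‼-take : ∀ n (xs : List A) i → i < n → take n xs ‼ i ≡ xs ‼ i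
‼-take (suc n) [] i _ = refl
‼-take (suc n) (x ∷ xs) zero _ = refl
‼-take (suc n) (x ∷ xs) (suc i) (s≤s i<n) = ‼-take n xs i i<n

‼-drop : ∀ n (xs : List A) i → drop n xs ‼ i ≡ xs ‼ (n + i)
‼-drop zero xs i = refl
‼-drop (suc n) [] i = refl
‼-drop (suc n) (x ∷ xs) i = ‼-drop n xs i

‼-applyUpTo : ∀ (f : ℕ → A) n i → i < n → applyUpTo f n ‼ i ≡ just (f i)
‼-applyUpTo f (suc n) zero _ = refl
‼-applyUpTo f (suc n) (suc i) (s≤s i<n) = ‼-applyUpTo (λ j → f (suc j)) n i i<n

infixl 5 _‼ᶻ_

_‼ᶻ_ : List A → ℤ → Maybe A
xs ‼ᶻ + i = xs ‼ i
xs ‼ᶻ -[1+ _ ] = nothing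

initial-‼ᶻ : ∀ {k} (C : ACA k) w z → initial C w z ≡ maybe (ACA.inp C) (ACA.q C) (w ‼ᶻ z)
initial-‼ᶻ C w -[1+ _ ] = refl
initial-‼ᶻ C w (+ i) = go w i
  where
  go : ∀ w i → initial C w (+ i) ≡ maybe (ACA.inp C) (ACA.q C) (w ‼ i)
  go [] i = refl
  go (a ∷ w) zero = refl
  go (a ∷ w) (suc i) = go w i

‼ᶻ-⊖ : ∀ (xs : List A) i d → xs ‼ᶻ (i ⊖ d) ≡ back xs d i
‼ᶻ-⊖ xs i zero = refl
‼ᶻ-⊖ xs zero (suc d) = refl
‼ᶻ-⊖ xs (suc i) (suc d) = trans (cong (xs ‼ᶻ_) (ℤ.[1+m]⊖[1+n]≡m⊖n i d)) (‼ᶻ-⊖ xs i d)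

‼ᶻ-- : ∀ (xs : List A) i d → xs ‼ᶻ (+ i ℤ.- + d) ≡ back xs d i
‼ᶻ-- xs i d = trans (cong (xs ‼ᶻ_) (ℤ.m-n≡m⊖n i d)) (‼ᶻ-⊖ xs i d)

-- Locality of cellular automata

window : ℤ → ℕ → ℕ → ℤ
window z τ d = z ℤ.- + τ ℤ.+ + d

module _ {k : ℕ} (C : ACA k) where
  open ACA C

  Δ^-local : ∀ τ (c c′ : Config C) z →
    (∀ d → d ≤ τ + τ → c (window z τ d) ≡ c′ (window z τ d)) →
    Δ^ C τ c z ≡ Δ^ C τ c′ z
  Δ^-local zero c c′ z agree = begin
    c z                  ≡⟨ cong c (sym (window-0 z)) ⟩
    c (window z 0 0)     ≡⟨ agree 0 z≤n ⟩
    c′ (window z 0 0)    ≡⟨ cong c′ (window-0 z) ⟩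
    c′ z                 ∎
    where
    open ≡-Reasoning
    window-0 : ∀ z → z ℤ.- + 0 ℤ.+ + 0 ≡ z
    window-0 = ℤ-Ring.solve-∀
  Δ^-local (suc τ) c c′ z agree = cong₃ δ
      (Δ^-local τ c c′ (ℤ.pred z) λ d d≤ → agree-at d (≤-trans (n≤1+n d) (≤-trans (n≤1+n (suc d)) (grow d≤))) (left z (+ τ) (+ d)))
      (Δ^-local τ c c′ z λ d d≤ → agree-at (suc d) (≤-trans (n≤1+n (suc d)) (grow d≤)) (mid z (+ τ) (+ d)))
      (Δ^-local τ c c′ (ℤ.suc z) λ d d≤ → agree-at (suc (suc d)) (grow d≤) (right z (+ τ) (+ d)))
    where
    agree-at : ∀ {y} d → d ≤ suc τ + suc τ → y ≡ window z (suc τ) d → c y ≡ c′ y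
    agree-at d d≤ refl = agree d d≤
    grow : ∀ {d} → d ≤ τ + τ → suc (suc d) ≤ suc τ + suc τ
    grow {d} d≤ = subst (suc (suc d) ≤_) (cong suc (sym (+-suc τ τ))) (s≤s (s≤s d≤))
    left : ∀ z t d → ℤ.-1ℤ ℤ.+ z ℤ.- t ℤ.+ d ≡ z ℤ.- (ℤ.1ℤ ℤ.+ t) ℤ.+ d
    left = ℤ-Ring.solve-∀
    mid : ∀ z t d → z ℤ.- t ℤ.+ d ≡ z ℤ.- (ℤ.1ℤ ℤ.+ t) ℤ.+ (ℤ.1ℤ ℤ.+ d)
    mid = ℤ-Ring.solve-∀
    right : ∀ z t d → ℤ.1ℤ ℤ.+ z ℤ.- t ℤ.+ d ≡ z ℤ.- (ℤ.1ℤ ℤ.+ t) ℤ.+ (ℤ.1ℤ ℤ.+ (ℤ.1ℤ ℤ.+ d))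
    right = ℤ-Ring.solve-∀

  Δ^-translate : ∀ τ (c : Config C) a z → Δ^ C τ (λ y → c (a ℤ.+ y)) z ≡ Δ^ C τ c (a ℤ.+ z)
  Δ^-translate zero c a z = refl
  Δ^-translate (suc τ) c a z = cong₃ δ
      (trans (Δ^-translate τ c a (ℤ.pred z)) (cong (Δ^ C τ c) (ℤ.+-pred a z)))
      (Δ^-translate τ c a z)
      (trans (Δ^-translate τ c a (ℤ.suc z)) (cong (Δ^ C τ c) (+-sucℤ a z)))
    where
    +-sucℤ : ∀ a z → a ℤ.+ (ℤ.1ℤ ℤ.+ z) ≡ ℤ.1ℤ ℤ.+ (a ℤ.+ z)
    +-sucℤ = ℤ-Ring.solve-∀

  Δ^-quiescent : ∀ τ (c : Config C) z → c z ≡ q → Δ^ C τ c z ≡ q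
  Δ^-quiescent zero c z cz≡q = cz≡q
  Δ^-quiescent (suc τ) c z cz≡q = Equivalence.from (δ-q _ _ _) (Δ^-quiescent τ c z cz≡q)

  Δ^-local-point : ∀ τ (c c′ : Config C) p z → (∀ y → y ≢ p → c y ≡ c′ y) →
    (∀ d → d ≤ τ + τ → window z τ d ≢ p) → Δ^ C τ c z ≡ Δ^ C τ c′ z
  Δ^-local-point τ c c′ p z agree outside = Δ^-local τ c c′ z λ d d≤ → agree _ (outside d d≤)

window-≢-right : ∀ i τ n → i + τ < n → ∀ d → d ≤ τ + τ → window (+ i) τ d ≢ + n
window-≢-right i τ n i+τ<n d d≤2τ window≡n = <-irrefl (ℤ.+-injective (trans (sym (window-+ (+ i) (+ τ) (+ d))) (cong (ℤ._+ + τ) window≡n)))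
  (begin-strict
    i + d           ≤⟨ +-monoʳ-≤ i d≤2τ ⟩
    i + (τ + τ)     ≡⟨ +-assoc i τ τ ⟨
    i + τ + τ       <⟨ +-monoˡ-< τ i+τ<n ⟩
    n + τ           ∎)
  where
  open ≤-Reasoning
  window-+ : ∀ z t d → z ℤ.- t ℤ.+ d ℤ.+ t ≡ z ℤ.+ d
  window-+ = ℤ-Ring.solve-∀

window-≢-left : ∀ j τ d → τ ≤ j → window (+ j) τ d ≢ -[1+ 0 ]
window-≢-left j τ d τ≤j window≡-1
  with () ← trans (sym (cong (ℤ._+ + d) (trans (ℤ.m-n≡m⊖n j τ) (ℤ.⊖-≥ τ≤j)))) window≡-1

-- REG ⊄ ACA(t) for t ∈ o(n)

unary : ℕ → List (Fin 1)
unary n = replicate n zero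

module _ (C : ACA 1) where
  open ACA C

  private
    initial-unary-< : ∀ n i → i < n → initial C (unary n) (+ i) ≡ inp zero
    initial-unary-< (suc n) zero i<n = refl
    initial-unary-< (suc n) (suc i) (s≤s i<n) = initial-unary-< n i i<n

    initial-unary-≥ : ∀ n i → n ≤ i → initial C (unary n) (+ i) ≡ q
    initial-unary-≥ zero i n≤i = refl
    initial-unary-≥ (suc n) (suc i) (s≤s n≤i) = initial-unary-≥ n i n≤i

  initial-unary-suc : ∀ n y → y ≢ + n → initial C (unary n) y ≡ initial C (unary (suc n)) y
  initial-unary-suc n -[1+ _ ] y≢n = refl
  initial-unary-suc n (+ i) y≢n with <-cmp i n
  ... | tri< i<n _ _ = trans (initial-unary-< n i i<n) (sym (initial-unary-< (suc n) i (m≤n⇒m≤1+n i<n)))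
  ... | tri≈ _ i≡n _ = ⊥-elim (y≢n (cong +_ i≡n))
  ... | tri> _ _ n<i = trans (initial-unary-≥ n i (<⇒≤ n<i)) (sym (initial-unary-≥ (suc n) i n<i))

  initial-unary-shift : ∀ n y → y ≢ -[1+ 0 ] → initial C (unary (suc n)) (ℤ.1ℤ ℤ.+ y) ≡ initial C (unary n) y
  initial-unary-shift n (+ i) y≢-1 = refl
  initial-unary-shift n -[1+ zero ] y≢-1 = ⊥-elim (y≢-1 refl)
  initial-unary-shift n -[1+ suc _ ] y≢-1 = refl

  private
    AccOrQ : Fin nQ → Set
    AccOrQ s = (acc s ≡ true) ⊎ (s ≡ q)

  accepts-unary-suc : ∀ n τ → τ + τ < n → AcceptsAt C (unary n) τ → AcceptsAt C (unary (suc n)) τ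
  accepts-unary-suc n τ 2τ<n acc -[1+ _ ] = inj₂ (Δ^-quiescent C τ _ _ refl)
  accepts-unary-suc n τ 2τ<n acc (+ i) with i + τ <? n
  ... | yes i+τ<n = subst AccOrQ
    (Δ^-local-point C τ _ _ (+ n) (+ i) (initial-unary-suc n) (window-≢-right i τ n i+τ<n))
    (acc (+ i))
  ... | no i+τ≮n = shifted i (+-cancelʳ-< τ τ i (<-≤-trans 2τ<n (≮⇒≥ i+τ≮n)))
    where
    shifted : ∀ i → τ < i → AccOrQ (Δ^ C τ (initial C (unary (suc n))) (+ i))
    shifted (suc j) (s≤s τ≤j) = subst AccOrQ
      (trans (sym (Δ^-local-point C τ _ _ -[1+ 0 ] (+ j) (initial-unary-shift n) (λ d _ → window-≢-left j τ d τ≤j)))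
             (Δ^-translate C τ (initial C (unary (suc n))) ℤ.1ℤ (+ j)))
      (acc (+ j))

parity : DFA 1
parity = record { nS = 2 ; start = zero ; step = λ s _ → opposite s ; final = λ s → toℕ s ≡ᵇ 1 }

run-parity-double : ∀ s m → run parity s (unary (m + m)) ≡ s
run-parity-double s zero = refl
run-parity-double s (suc m) rewrite +-suc m m =
  trans (run-parity-double (opposite (opposite s)) m) (opposite-involutive s)

odd-accepted : ∀ m → LangDFA parity (unary (suc (m + m)))
odd-accepted m = (λ ()) , cong (λ s → toℕ s ≡ᵇ 1) (run-parity-double (suc zero) m)

even-rejected : ∀ m → ¬ LangDFA parity (unary (suc (suc (m + m))))
even-rejected m (_ , final) with () ← trans (cong (λ s → toℕ s ≡ᵇ 1) (sym (run-parity-double zero m))) final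

3τ≤n⇒τ+τ<n : ∀ τ n → 3 * τ ≤ n → 0 < n → τ + τ < n
3τ≤n⇒τ+τ<n zero n _ 0<n = 0<n
3τ≤n⇒τ+τ<n (suc τ) n 3τ≤n _ = <-≤-trans (+-monoʳ-< (suc τ) (m<m+n (suc τ) (s≤s z≤n))) 3τ≤n

REG⊄ACA : ∀ t → Is-o-n t → ¬ REG⊆ACA t
REG⊄ACA t t∈o[n] REG⊆ACA with t∈o[n] 3 | REG⊆ACA 1 (LangDFA parity) (parity , λ _ → mk⇔ id id)
... | N , 3t≤n | C , parity≐C , fast = even-rejected N (Equivalence.from (parity≐C (unary (suc n))) longer-accepted)
  where
  n = suc (N + N)
  accepted = fast (unary n) (Equivalence.to (parity≐C (unary n)) (odd-accepted N))
  τ = proj₁ accepted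
  τ≤t : τ ≤ t n
  τ≤t = subst (λ m → τ ≤ t m) (length-replicate n) (proj₁ (proj₂ accepted))
  longer-accepted : LangACA C (unary (suc n))
  longer-accepted = (λ ()) , τ , accepts-unary-suc C n τ
    (3τ≤n⇒τ+τ<n τ n (≤-trans (*-monoʳ-≤ 3 τ≤t) (3t≤n n (≤-trans (m≤m+n N N) (n≤1+n _)))) (s≤s z≤n))
    (proj₂ (proj₂ accepted))

-- Base-B counters

bit : Bool → ℕ
bit false = 0
bit true = 1

≡ᵇ-refl : ∀ n → (n ≡ᵇ n) ≡ true
≡ᵇ-refl zero = refl
≡ᵇ-refl (suc n) = ≡ᵇ-refl n

≡ᵇ-true⇒≡ : ∀ m n → (m ≡ᵇ n) ≡ true → m ≡ n
≡ᵇ-true⇒≡ m n eq = ≡ᵇ⇒≡ m n (subst T (sym eq) _)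

-- A digit row D : ℕ → ℕ is read least significant digit first; carry D p is the carry
-- into digit p when one is added to the row.
module Counter (B : ℕ) (1≤B : 1 ≤ B) where

  top : ℕ
  top = B ∸ 1

  isTop : ℕ → Bool
  isTop d = d ≡ᵇ top

  bump : ℕ → Bool → ℕ
  bump d false = d
  bump d true = if isTop d then 0 else suc d

  carry : (ℕ → ℕ) → ℕ → Bool
  carry D zero = true
  carry D (suc p) = carry D p ∧ isTop (D p)

  value : (ℕ → ℕ) → ℕ → ℕ
  value D zero = 0
  value D (suc p) = value D p + B ^ p * D p

  Successor : (ℕ → ℕ) → (ℕ → ℕ) → ℕ → Set
  Successor D D′ ℓ = ∀ p → p < ℓ → D′ p ≡ bump (D p) (carry D p)

  AllBelow : (ℕ → ℕ) → ℕ → ℕ → Set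
  AllBelow D ℓ b = ∀ p → p < ℓ → D p < b

  AllEqual : (ℕ → ℕ) → ℕ → ℕ → Set
  AllEqual D ℓ d = ∀ p → p < ℓ → D p ≡ d

  isTop⇒≡top : ∀ d → isTop d ≡ true → d ≡ top
  isTop⇒≡top d = ≡ᵇ-true⇒≡ d top

  isTop-top : isTop top ≡ true
  isTop-top = ≡ᵇ-refl top

  bump-carry : ∀ d c → bump d c + B * bit (c ∧ isTop d) ≡ d + bit c
  bump-carry d false = cong (λ x → d + x) (*-zeroʳ B)
  bump-carry d true with isTop d in eq
  ... | true = begin
    0 + B * 1     ≡⟨ *-identityʳ B ⟩
    B             ≡⟨ m∸n+n≡m 1≤B ⟨
    top + 1       ≡⟨ cong (_+ 1) (isTop⇒≡top d eq) ⟨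
    d + 1         ∎
    where open ≡-Reasoning
  ... | false = trans (cong (λ x → suc d + x) (*-zeroʳ B)) (trans (+-identityʳ (suc d)) (+-comm 1 d))

  value-succ : ∀ D D′ ℓ → Successor D D′ ℓ → value D′ ℓ + B ^ ℓ * bit (carry D ℓ) ≡ value D ℓ + 1
  value-succ D D′ zero succ = refl
  value-succ D D′ (suc ℓ) succ = begin
    value D′ ℓ + B ^ ℓ * D′ ℓ + B * B ^ ℓ * bit (c ∧ isTop (D ℓ))
      ≡⟨ regroup (value D′ ℓ) (B ^ ℓ) (D′ ℓ) B (bit (c ∧ isTop (D ℓ))) ⟩
    value D′ ℓ + B ^ ℓ * (D′ ℓ + B * bit (c ∧ isTop (D ℓ)))
      ≡⟨ cong (λ d → value D′ ℓ + B ^ ℓ * (d + B * bit (c ∧ isTop (D ℓ)))) (succ ℓ ≤-refl) ⟩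
    value D′ ℓ + B ^ ℓ * (bump (D ℓ) c + B * bit (c ∧ isTop (D ℓ)))
      ≡⟨ cong (λ e → value D′ ℓ + B ^ ℓ * e) (bump-carry (D ℓ) c) ⟩
    value D′ ℓ + B ^ ℓ * (D ℓ + bit c)
      ≡⟨ split (value D′ ℓ) (B ^ ℓ) (D ℓ) (bit c) ⟩
    value D′ ℓ + B ^ ℓ * bit c + B ^ ℓ * D ℓ
      ≡⟨ cong (_+ B ^ ℓ * D ℓ) (value-succ D D′ ℓ (λ p p<ℓ → succ p (m<n⇒m<1+n p<ℓ))) ⟩
    value D ℓ + 1 + B ^ ℓ * D ℓ
      ≡⟨ swap (value D ℓ) (B ^ ℓ * D ℓ) ⟩
    value D ℓ + B ^ ℓ * D ℓ + 1 ∎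
    where
    open ≡-Reasoning
    c = carry D ℓ
    regroup : ∀ v x d b e → v + x * d + b * x * e ≡ v + x * (d + b * e)
    regroup = ℕ-Ring.solve-∀
    split : ∀ v x d e → v + x * (d + e) ≡ v + x * e + x * d
    split = ℕ-Ring.solve-∀
    swap : ∀ v y → v + 1 + y ≡ v + y + 1
    swap = ℕ-Ring.solve-∀

  value-< : ∀ D ℓ → AllBelow D ℓ B → value D ℓ < B ^ ℓ
  value-< D zero _ = s≤s z≤n
  value-< D (suc ℓ) below = begin-strict
    value D ℓ + B ^ ℓ * D ℓ   <⟨ +-monoˡ-< (B ^ ℓ * D ℓ) (value-< D ℓ (λ p p<ℓ → below p (m<n⇒m<1+n p<ℓ))) ⟩
    B ^ ℓ + B ^ ℓ * D ℓ       ≡⟨ *-suc (B ^ ℓ) (D ℓ) ⟨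
    B ^ ℓ * suc (D ℓ)         ≤⟨ *-monoʳ-≤ (B ^ ℓ) (below ℓ ≤-refl) ⟩
    B ^ ℓ * B                 ≡⟨ *-comm (B ^ ℓ) B ⟩
    B * B ^ ℓ                 ∎
    where open ≤-Reasoning

  value-zeros : ∀ D ℓ → AllEqual D ℓ 0 → value D ℓ ≡ 0
  value-zeros D zero _ = refl
  value-zeros D (suc ℓ) zeros
    rewrite value-zeros D ℓ (λ p p<ℓ → zeros p (m<n⇒m<1+n p<ℓ)) | zeros ℓ ≤-refl = *-zeroʳ (B ^ ℓ)

  value-tops : ∀ D ℓ → AllEqual D ℓ top → value D ℓ + 1 ≡ B ^ ℓ
  value-tops D zero _ = refl
  value-tops D (suc ℓ) tops = begin
    value D ℓ + B ^ ℓ * D ℓ + 1   ≡⟨ cong (λ d → value D ℓ + B ^ ℓ * d + 1) (tops ℓ ≤-refl) ⟩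
    value D ℓ + B ^ ℓ * top + 1   ≡⟨ swap (value D ℓ) (B ^ ℓ * top) ⟩
    value D ℓ + 1 + B ^ ℓ * top   ≡⟨ cong (_+ B ^ ℓ * top) (value-tops D ℓ (λ p p<ℓ → tops p (m<n⇒m<1+n p<ℓ))) ⟩
    B ^ ℓ + B ^ ℓ * top           ≡⟨ *-suc (B ^ ℓ) top ⟨
    B ^ ℓ * suc top               ≡⟨ cong (B ^ ℓ *_) (trans (+-comm 1 top) (m∸n+n≡m 1≤B)) ⟩
    B ^ ℓ * B                     ≡⟨ *-comm (B ^ ℓ) B ⟩
    B * B ^ ℓ                     ∎
    where
    open ≡-Reasoning
    swap : ∀ v y → v + y + 1 ≡ v + 1 + y
    swap = ℕ-Ring.solve-∀

  carry⇒tops : ∀ D ℓ → carry D ℓ ≡ true → AllEqual D ℓ top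
  carry⇒tops D (suc ℓ) eq p p<1+ℓ with m≤n⇒m<n∨m≡n (≤-pred p<1+ℓ) | carry D ℓ in eq′ | isTop (D ℓ) in eq″
  carry⇒tops D (suc ℓ) eq p _ | inj₁ p<ℓ  | true | true = carry⇒tops D ℓ eq′ p p<ℓ
  carry⇒tops D (suc ℓ) eq p _ | inj₂ refl | true | true = isTop⇒≡top (D p) eq″

  bump-< : ∀ d c → d < B → bump d c < B
  bump-< d false d<B = d<B
  bump-< d true d<B with isTop d in eq
  ... | true = 1≤B
  ... | false with m≤n⇒m<n∨m≡n d<B
  ...   | inj₁ 1+d<B = 1+d<B
  ...   | inj₂ 1+d≡B with () ← trans (sym eq) (subst (λ x → isTop x ≡ true) (cong ℕ.pred (sym 1+d≡B)) isTop-top)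

  count-length : ∀ ℓ m (D : ℕ → ℕ → ℕ) → AllEqual (D 0) ℓ 0 →
    (∀ j → j < m → Successor (D j) (D (suc j)) ℓ) → AllEqual (D m) ℓ top → B ^ ℓ ≤ suc m
  count-length ℓ m D zeros succ tops = begin
    B ^ ℓ              ≡⟨ value-tops (D m) ℓ tops ⟨
    value (D m) ℓ + 1  ≤⟨ +-monoˡ-≤ 1 (value≤ m ≤-refl) ⟩
    m + 1              ≡⟨ +-comm m 1 ⟩
    suc m              ∎
    where
    open ≤-Reasoning
    value≤ : ∀ j → j ≤ m → value (D j) ℓ ≤ j
    value≤ zero _ = ≤-reflexive (value-zeros (D 0) ℓ zeros)
    value≤ (suc j) j<m = begin
      value (D (suc j)) ℓ                                  ≤⟨ m≤m+n _ _ ⟩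
      value (D (suc j)) ℓ + B ^ ℓ * bit (carry (D j) ℓ)    ≡⟨ value-succ (D j) (D (suc j)) ℓ (succ j j<m) ⟩
      value (D j) ℓ + 1                                    ≤⟨ +-monoˡ-≤ 1 (value≤ j (<⇒≤ j<m)) ⟩
      j + 1                                                ≡⟨ +-comm j 1 ⟩
      suc j                                                ∎

  count : ℕ → ℕ → ℕ
  count zero p = 0
  count (suc j) p = bump (count j p) (carry (count j) p)

  count-< : ∀ j p → count j p < B
  count-< zero p = 1≤B
  count-< (suc j) p = bump-< (count j p) (carry (count j) p) (count-< j p)

  private
    count-step : ∀ j ℓ → value (count (suc j)) ℓ + B ^ ℓ * bit (carry (count j) ℓ) ≡ value (count j) ℓ + 1
    count-step j ℓ = value-succ (count j) (count (suc j)) ℓ (λ _ _ → refl)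

    count-step-carry : ∀ j ℓ → carry (count j) ℓ ≡ true → value (count (suc j)) ℓ + B ^ ℓ ≡ value (count j) ℓ + 1
    count-step-carry j ℓ c≡true = begin
      value (count (suc j)) ℓ + B ^ ℓ                            ≡⟨ cong (λ x → value (count (suc j)) ℓ + x) (*-identityʳ (B ^ ℓ)) ⟨
      value (count (suc j)) ℓ + B ^ ℓ * 1                        ≡⟨ cong (λ c → value (count (suc j)) ℓ + B ^ ℓ * bit c) c≡true ⟨
      value (count (suc j)) ℓ + B ^ ℓ * bit (carry (count j) ℓ)  ≡⟨ count-step j ℓ ⟩
      value (count j) ℓ + 1                                      ∎
      where open ≡-Reasoning

    count-step-no-carry : ∀ j ℓ → carry (count j) ℓ ≡ false → value (count (suc j)) ℓ ≡ value (count j) ℓ + 1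
    count-step-no-carry j ℓ c≡false = begin
      value (count (suc j)) ℓ                                    ≡⟨ +-identityʳ _ ⟨
      value (count (suc j)) ℓ + 0                                ≡⟨ cong (λ x → value (count (suc j)) ℓ + x) (*-zeroʳ (B ^ ℓ)) ⟨
      value (count (suc j)) ℓ + B ^ ℓ * 0                        ≡⟨ cong (λ c → value (count (suc j)) ℓ + B ^ ℓ * bit c) c≡false ⟨
      value (count (suc j)) ℓ + B ^ ℓ * bit (carry (count j) ℓ)  ≡⟨ count-step j ℓ ⟩
      value (count j) ℓ + 1                                      ∎
      where open ≡-Reasoning

  value-count : ∀ ℓ j → j < B ^ ℓ → value (count j) ℓ ≡ j
  value-count ℓ zero _ = value-zeros (count 0) ℓ (λ _ _ → refl)
  value-count ℓ (suc j) 1+j<B^ℓ with carry (count j) ℓ in eq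
  ... | true = ⊥-elim (<-irrefl refl (begin-strict
    B ^ ℓ                            ≤⟨ m≤n+m (B ^ ℓ) _ ⟩
    value (count (suc j)) ℓ + B ^ ℓ  ≡⟨ count-step-carry j ℓ eq ⟩
    value (count j) ℓ + 1            ≡⟨ cong (_+ 1) (value-count ℓ j (<-trans (n<1+n j) 1+j<B^ℓ)) ⟩
    j + 1                            ≡⟨ +-comm j 1 ⟩
    suc j                            <⟨ 1+j<B^ℓ ⟩
    B ^ ℓ                            ∎))
    where open ≤-Reasoning
  ... | false = trans (count-step-no-carry j ℓ eq)
                      (trans (cong (_+ 1) (value-count ℓ j (<-trans (n<1+n j) 1+j<B^ℓ))) (+-comm j 1))

  carry-count-last : ∀ ℓ j → suc j ≡ B ^ ℓ → carry (count j) ℓ ≡ true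
  carry-count-last ℓ j 1+j≡B^ℓ with carry (count j) ℓ in eq
  ... | true = refl
  ... | false = ⊥-elim (<-irrefl value≡B^ℓ (value-< (count (suc j)) ℓ (λ p _ → count-< (suc j) p)))
    where
    value≡B^ℓ : value (count (suc j)) ℓ ≡ B ^ ℓ
    value≡B^ℓ = trans (count-step-no-carry j ℓ eq)
      (trans (cong (_+ 1) (value-count ℓ j (subst (j <_) 1+j≡B^ℓ ≤-refl))) (trans (+-comm j 1) 1+j≡B^ℓ))

-- Counter words and an ACA recognising them

Maybe↔Fin : ∀ {n} → A ↔ Fin n → Maybe A ↔ Fin (suc n)
Maybe↔Fin {A} {n} A↔ = mk↔ₛ′ to from to∘from from∘to
  where
  open Inverse A↔ using () renaming (to to toA; from to fromA)
  to : Maybe A → Fin (suc n)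
  to = maybe (λ a → suc (toA a)) zero
  from : Fin (suc n) → Maybe A
  from zero = nothing
  from (suc i) = just (fromA i)
  to∘from : ∀ i → to (from i) ≡ i
  to∘from zero = refl
  to∘from (suc i) = cong suc (Inverse.strictlyInverseˡ A↔ i)
  from∘to : ∀ x → from (to x) ≡ x
  from∘to nothing = refl
  from∘to (just a) = cong just (Inverse.strictlyInverseʳ A↔ a)

×↔Fin : ∀ {m n} → A ↔ Fin m → C ↔ Fin n → (A × C) ↔ Fin (m * n)
×↔Fin A↔ C↔ = ↔-trans (A↔ ×-↔ C↔) (↔-sym *↔×)

data Letter : Set where
  hash : Letter
  digit : ℕ → Bool → Letter

isHash : Letter → Bool
isHash hash = true
isHash (digit _ _) = false

isHash⇒≡hash : ∀ s → isHash s ≡ true → s ≡ hash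
isHash⇒≡hash hash _ = refl

¬isHash⇒digit : ∀ s → isHash s ≡ false → ∃[ d ] ∃[ c ] (s ≡ digit d c)
¬isHash⇒digit (digit d c) _ = d , c , refl

_==_ : Bool → Bool → Bool
true == b = b
false == b = not b

==-refl : ∀ b → (b == b) ≡ true
==-refl true = refl
==-refl false = refl

==⇒≡ : ∀ b c → (b == c) ≡ true → b ≡ c
==⇒≡ true true _ = refl
==⇒≡ false false _ = refl

just⇒¬is-nothing : ∀ {A : Set} {m : Maybe A} {x} → m ≡ just x → is-nothing m ≢ true
just⇒¬is-nothing refl ()

block-+ : ∀ r j τ → r + suc j * τ ≡ τ + (r + j * τ)
block-+ r j τ = shuffle r (j * τ) τ
  where
  shuffle : ∀ r x t → r + (t + x) ≡ t + (r + x)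
  shuffle = ℕ-Ring.solve-∀

/-block : ∀ r j τ .{{_ : ℕ.NonZero τ}} → r < τ → (r + j * τ) / τ ≡ j
/-block r j τ r<τ = trans (+-distrib-/-∣ʳ r (divides j refl)) (cong₂ _+_ (m<n⇒m/n≡0 r<τ) (m*n/n≡m j τ))

%-block : ∀ r j τ .{{_ : ℕ.NonZero τ}} → r < τ → (r + j * τ) % τ ≡ r
%-block r j τ r<τ = trans ([m+kn]%n≡m%n r j τ) (m<n⇒m%n≡m r<τ)

run-++ : ∀ {k} (D : DFA k) s xs ys → run D s (xs ++ ys) ≡ run D (run D s xs) ys
run-++ D s [] ys = refl
run-++ D s (a ∷ xs) ys = run-++ D (DFA.step D s a) xs ys

module CounterLanguage (B : ℕ) (2≤B : 2 ≤ B) where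

  open Counter B (≤-trans (s≤s z≤n) 2≤B) public

  k : ℕ
  k = suc (B * 2)

  decode : Fin k → Letter
  decode zero = hash
  decode (suc x) = digit (toℕ (proj₁ (remQuot {B} 2 x))) (Inverse.to 2↔Bool (proj₂ (remQuot {B} 2 x)))

  encodeDigit : ∀ d → d < B → Bool → Fin k
  encodeDigit d d<B c = suc (combine {B} (fromℕ< d<B) (Inverse.from 2↔Bool c))

  decode-encodeDigit : ∀ d d<B c → decode (encodeDigit d d<B c) ≡ digit d c
  decode-encodeDigit d d<B c = trans
    (cong (λ p → digit (toℕ (proj₁ p)) (Inverse.to 2↔Bool (proj₂ p)))
          (remQuot-combine {B} {2} (fromℕ< d<B) (Inverse.from 2↔Bool c)))
    (cong₂ digit (toℕ-fromℕ< d<B) (Inverse.strictlyInverseˡ 2↔Bool c))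

  -- Checks on a letter given its neighbours and the letters τ cells to its left and right.
  -- Together they say that the word is #w₀#w₁#⋯#w_{m−1}# with blocks of length τ − 1,
  -- w₀ = 0⋯0, w_{m−1} = (B−1)⋯(B−1), w_{j+1} the successor of w_j, and correct carry tags.
  startsWithHash : Maybe Letter → Letter → Bool
  startsWithHash nothing a = isHash a
  startsWithHash (just _) _ = true

  hashFollowedByDigit : Maybe Letter → Letter → Maybe Letter → Bool
  hashFollowedByDigit _ (digit _ _) _ = true
  hashFollowedByDigit _ hash (just hash) = false
  hashFollowedByDigit nothing hash nothing = false
  hashFollowedByDigit _ hash _ = true

  endsWithHash : Maybe Letter → Letter → Bool
  endsWithHash nothing a = isHash a
  endsWithHash (just _) _ = true

  carryCorrect : Maybe Letter → Letter → Bool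
  carryCorrect (just hash) (digit _ c) = c
  carryCorrect (just (digit d′ c′)) (digit _ c) = c == (c′ ∧ isTop d′)
  carryCorrect _ _ = true

  incrementsPrevious : Maybe Letter → Maybe Letter → Letter → Bool
  incrementsPrevious nothing left hash = is-nothing left
  incrementsPrevious nothing _ (digit d _) = d ≡ᵇ 0
  incrementsPrevious (just hash) _ a = isHash a
  incrementsPrevious (just (digit _ _)) _ hash = false
  incrementsPrevious (just (digit d′ c′)) _ (digit d _) = d ≡ᵇ bump d′ c′

  lastBlockTop : Maybe Letter → Letter → Bool
  lastBlockTop nothing (digit d _) = isTop d
  lastBlockTop _ _ = true

  locallyValid : Letter → Maybe Letter → Maybe Letter → Maybe Letter → Maybe Letter → Bool
  locallyValid a left right farLeft farRight =
    startsWithHash left a ∧ hashFollowedByDigit left a right ∧ endsWithHash right a ∧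
    carryCorrect left a ∧ incrementsPrevious farLeft left a ∧ lastBlockTop farRight a

  -- A live cell keeps its input letter, the letters of its two neighbours, and two letters
  -- moving one cell per step to the right and to the left, which after τ steps are the input
  -- letters τ cells to its left and right.
  Cell : Set
  Cell = Fin k × Maybe (Fin k) × Maybe (Fin k) × Maybe (Fin k) × Maybe (Fin k)

  letterOf : Maybe Cell → Maybe (Fin k)
  letterOf = Maybe.map proj₁

  farLeftOf : Maybe Cell → Maybe (Fin k)
  farLeftOf nothing = nothing
  farLeftOf (just (_ , _ , _ , l , _)) = l

  farRightOf : Maybe Cell → Maybe (Fin k)
  farRightOf nothing = nothing
  farRightOf (just (_ , _ , _ , _ , r)) = r

  step : Maybe Cell → Maybe Cell → Maybe Cell → Maybe Cell
  step x nothing y = nothing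
  step x (just (a , _)) y = just (a , letterOf x , letterOf y , farLeftOf x , farRightOf y)

  freshCell : Fin k → Cell
  freshCell a = a , nothing , nothing , just a , just a

  accepting : Maybe Cell → Bool
  accepting nothing = false
  accepting (just (a , l , r , fl , fr)) =
    locallyValid (decode a) (Maybe.map decode l) (Maybe.map decode r) (Maybe.map decode fl) (Maybe.map decode fr)

  nQ : ℕ
  nQ = suc (k * (suc k * (suc k * (suc k * suc k))))

  opaque
    encoding : Maybe Cell ↔ Fin nQ
    encoding = Maybe↔Fin (×↔Fin ↔-refl (×↔Fin letter (×↔Fin letter (×↔Fin letter letter))))
      where
      letter : Maybe (Fin k) ↔ Fin (suc k)
      letter = Maybe↔Fin ↔-refl

  open Inverse encoding using () renaming (to to encode; from to decodeCell; strictlyInverseʳ to decode∘encode; strictlyInverseˡ to encode∘decode)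

  encode-injective : ∀ x y → encode x ≡ encode y → x ≡ y
  encode-injective x y eq = trans (sym (decode∘encode x)) (trans (cong decodeCell eq) (decode∘encode y))

  counterACA : ACA k
  counterACA = record
    { nQ = nQ
    ; δ = λ x y z → encode (step (decodeCell x) (decodeCell y) (decodeCell z))
    ; inp = λ a → encode (just (freshCell a))
    ; inp-inj = λ a b eq → cong (maybe proj₁ a) (encode-injective (just (freshCell a)) (just (freshCell b)) eq)
    ; q = encode nothing
    ; q∉Σ = λ a eq → just≢nothing (encode-injective (just (freshCell a)) nothing eq)
    ; δ-q = λ x y z → mk⇔
        (λ eq → trans (sym (encode∘decode y)) (cong encode (step-nothing (decodeCell x) (decodeCell y) (decodeCell z) (encode-injective (step (decodeCell x) (decodeCell y) (decodeCell z)) nothing eq))))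
        (λ y≡q → cong encode (subst (λ u → step (decodeCell x) u (decodeCell z) ≡ nothing) (sym (trans (cong decodeCell y≡q) (decode∘encode nothing))) refl))
    ; acc = λ x → accepting (decodeCell x)
    ; acc-ne = encode acceptingCell , cong accepting (decode∘encode acceptingCell)
    ; q∉A = cong accepting (decode∘encode nothing)
    }
    where
    just≢nothing : ∀ {x : Cell} → just x ≢ nothing
    just≢nothing ()
    step-nothing : ∀ x y z → step x y z ≡ nothing → y ≡ nothing
    step-nothing x nothing z _ = refl
    acceptingCell : Maybe Cell
    acceptingCell = just (zero , just zero , nothing , just zero , nothing)

  ValidAt : List Letter → ℕ → ℕ → Letter → Set
  ValidAt v τ i s = locallyValid s (back v 1 i) (v ‼ suc i) (back v τ i) (v ‼ (i + τ)) ≡ true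

  Valid : List Letter → ℕ → Set
  Valid v τ = ∀ i s → v ‼ i ≡ just s → ValidAt v τ i s

  module Run (w : List (Fin k)) where

    neighbour : ℕ → ℤ → Maybe (Fin k)
    neighbour zero _ = nothing
    neighbour (suc _) y = w ‼ᶻ y

    cellAt : ℕ → ℤ → Maybe Cell
    cellAt τ z = Maybe.map (λ a → a , neighbour τ (ℤ.pred z) , neighbour τ (ℤ.suc z) , w ‼ᶻ (z ℤ.- + τ) , w ‼ᶻ (z ℤ.+ + τ)) (w ‼ᶻ z)

    letterOf-cellAt : ∀ τ z → letterOf (cellAt τ z) ≡ w ‼ᶻ z
    letterOf-cellAt τ z with w ‼ᶻ z
    ... | nothing = refl
    ... | just _ = refl

    farLeftOf-cellAt : ∀ τ z a → w ‼ᶻ z ≡ just a → farLeftOf (cellAt τ (ℤ.pred z)) ≡ w ‼ᶻ (z ℤ.- + suc τ)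
    farLeftOf-cellAt τ z a w[z] with w ‼ᶻ ℤ.pred z in w[z-1]
    ... | just _ = cong (w ‼ᶻ_) (pred-- z (+ τ))
      where
      pred-- : ∀ z t → ℤ.-1ℤ ℤ.+ z ℤ.- t ≡ z ℤ.- (ℤ.1ℤ ℤ.+ t)
      pred-- = ℤ-Ring.solve-∀
    farLeftOf-cellAt τ (+ zero) a w[z] | nothing = refl
    farLeftOf-cellAt τ (+ suc i) a w[z] | nothing
      with () ← trans (sym (‼-nothing-+ w i 1 w[z-1])) (trans (cong (w ‼_) (+-comm i 1)) w[z])

    farRightOf-cellAt : ∀ τ z a → w ‼ᶻ z ≡ just a → farRightOf (cellAt τ (ℤ.suc z)) ≡ w ‼ᶻ (z ℤ.+ + suc τ)
    farRightOf-cellAt τ z a w[z] with w ‼ᶻ ℤ.suc z in w[z+1]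
    ... | just _ = cong (w ‼ᶻ_) (suc-+ z (+ τ))
      where
      suc-+ : ∀ z t → ℤ.1ℤ ℤ.+ z ℤ.+ t ≡ z ℤ.+ (ℤ.1ℤ ℤ.+ t)
      suc-+ = ℤ-Ring.solve-∀
    farRightOf-cellAt τ (+ i) a w[z] | nothing = sym (trans (cong (w ‼_) (+-suc i τ)) (‼-nothing-+ w (suc i) τ w[z+1]))

    step-cellAt : ∀ τ z → step (cellAt τ (ℤ.pred z)) (cellAt τ z) (cellAt τ (ℤ.suc z)) ≡ cellAt (suc τ) z
    step-cellAt τ z with w ‼ᶻ z in w[z]
    ... | nothing = refl
    ... | just a rewrite letterOf-cellAt τ (ℤ.pred z) | letterOf-cellAt τ (ℤ.suc z)
                       | farLeftOf-cellAt τ z a w[z] | farRightOf-cellAt τ z a w[z] = refl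

    configuration : ℕ → Config counterACA
    configuration τ = Δ^ counterACA τ (initial counterACA w)

    cellAt-nothing : ∀ τ z → w ‼ᶻ z ≡ nothing → cellAt τ z ≡ nothing
    cellAt-nothing τ z w[z] rewrite w[z] = refl

    cellAt-just : ∀ τ z a → w ‼ᶻ z ≡ just a → cellAt τ z ≢ nothing
    cellAt-just τ z a w[z] rewrite w[z] = λ ()

    initial-cellAt : ∀ z → decodeCell (initial counterACA w z) ≡ cellAt 0 z
    initial-cellAt z rewrite initial-‼ᶻ counterACA w z with w ‼ᶻ z in w[z]
    ... | nothing = decode∘encode nothing
    ... | just a = trans (decode∘encode (just (freshCell a))) (cong (λ m → just (a , nothing , nothing , m , m)) far≡a)
      where
      far≡a : just a ≡ w ‼ᶻ (z ℤ.+ + 0)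
      far≡a = sym (trans (cong (w ‼ᶻ_) (ℤ.+-identityʳ z)) w[z])

    decode-configuration : ∀ τ z → decodeCell (configuration τ z) ≡ cellAt τ z
    decode-configuration zero z = initial-cellAt z
    decode-configuration (suc τ) z = begin
      decodeCell (encode (step (decodeCell (configuration τ (ℤ.pred z))) (decodeCell (configuration τ z)) (decodeCell (configuration τ (ℤ.suc z)))))
        ≡⟨ decode∘encode _ ⟩
      step (decodeCell (configuration τ (ℤ.pred z))) (decodeCell (configuration τ z)) (decodeCell (configuration τ (ℤ.suc z)))
        ≡⟨ cong₃ step (decode-configuration τ (ℤ.pred z)) (decode-configuration τ z) (decode-configuration τ (ℤ.suc z)) ⟩
      step (cellAt τ (ℤ.pred z)) (cellAt τ z) (cellAt τ (ℤ.suc z))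
        ≡⟨ step-cellAt τ z ⟩
      cellAt (suc τ) z ∎
      where open ≡-Reasoning

    accepts-at⇔ : ∀ τ → AcceptsAt counterACA w τ ⇔ (∀ z a → w ‼ᶻ z ≡ just a → accepting (cellAt τ z) ≡ true)
    accepts-at⇔ τ = mk⇔ accepted⇒ ⇒accepted
      where
      accepted⇒ : AcceptsAt counterACA w τ → ∀ z a → w ‼ᶻ z ≡ just a → accepting (cellAt τ z) ≡ true
      accepted⇒ acc z a w[z] with acc z
      ... | inj₁ accepting-state = trans (cong accepting (sym (decode-configuration τ z))) accepting-state
      ... | inj₂ quiescent = ⊥-elim (cellAt-just τ z a w[z]
            (trans (sym (decode-configuration τ z)) (trans (cong decodeCell quiescent) (decode∘encode nothing))))
      ⇒accepted : (∀ z a → w ‼ᶻ z ≡ just a → accepting (cellAt τ z) ≡ true) → AcceptsAt counterACA w τ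
      ⇒accepted valid z with w ‼ᶻ z in w[z]
      ... | nothing = inj₂ (trans (sym (encode∘decode (configuration τ z)))
                                  (cong encode (trans (decode-configuration τ z) (cellAt-nothing τ z w[z]))))
      ... | just a = inj₁ (trans (cong accepting (decode-configuration τ z)) (valid z a w[z]))

    ‼ᶻ-pred : ∀ i → w ‼ᶻ ℤ.pred (+ i) ≡ back w 1 i
    ‼ᶻ-pred zero = refl
    ‼ᶻ-pred (suc i) = refl

    accepting-cellAt : ∀ τ i a → w ‼ i ≡ just a →
      accepting (cellAt (suc τ) (+ i)) ≡
      locallyValid (decode a) (back (map decode w) 1 i) (map decode w ‼ suc i) (back (map decode w) (suc τ) i) (map decode w ‼ (i + suc τ))
    accepting-cellAt τ i a w[i]
      rewrite w[i] | ‼ᶻ-pred i | ‼ᶻ-- w i (suc τ)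
            | back-map decode w 1 i | back-map decode w (suc τ) i | ‼-map decode w (suc i) | ‼-map decode w (i + suc τ) = refl

    accepts⇔valid : ∀ τ → AcceptsAt counterACA w (suc τ) ⇔ Valid (map decode w) (suc τ)
    accepts⇔valid τ = mk⇔
      (λ acc i s v[i] → let (a , w[i] , a↦s) = ‼-map-just decode w i v[i] in
        subst (ValidAt (map decode w) (suc τ) i) a↦s
          (trans (sym (accepting-cellAt τ i a w[i])) (Equivalence.to (accepts-at⇔ (suc τ)) acc (+ i) a w[i])))
      (λ valid → Equivalence.from (accepts-at⇔ (suc τ)) λ where
        (+ i) a w[i] → trans (accepting-cellAt τ i a w[i]) (valid i (decode a) (trans (‼-map decode w i) (cong (Maybe.map decode) w[i])))
        -[1+ _ ] a ())

    ¬accepts-at-0 : w ≢ [] → ¬ AcceptsAt counterACA w 0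
    ¬accepts-at-0 w≢[] acc =
      let (a , w[0]) = ≢[]⇒‼0 w w≢[] in isolated-invalid a w[0] (Equivalence.to (accepts-at⇔ 0) acc (+ 0) a w[0])
      where
      isolated-invalid : ∀ a → w ‼ 0 ≡ just a → accepting (cellAt 0 (+ 0)) ≢ true
      isolated-invalid a w[0] rewrite w[0] with decode a
      ... | hash = λ ()
      ... | digit _ _ = λ ()

  record Checks (a : Letter) (left right farLeft farRight : Maybe Letter) : Set where
    field
      starts : startsWithHash left a ≡ true
      follows : hashFollowedByDigit left a right ≡ true
      ends : endsWithHash right a ≡ true
      carries : carryCorrect left a ≡ true
      increments : incrementsPrevious farLeft left a ≡ true
      lastTop : lastBlockTop farRight a ≡ true

  checks : ∀ a l r L R → locallyValid a l r L R ≡ true → Checks a l r L R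
  checks a l r L R valid
    with startsWithHash l a in e₁ | hashFollowedByDigit l a r in e₂ | endsWithHash r a in e₃
       | carryCorrect l a in e₄ | incrementsPrevious L l a in e₅ | lastBlockTop R a in e₆
  ... | true | true | true | true | true | true = record
    { starts = e₁ ; follows = e₂ ; ends = e₃ ; carries = e₄ ; increments = e₅ ; lastTop = e₆ }

  checks⇒valid : ∀ v τ i s → Checks s (back v 1 i) (v ‼ suc i) (back v τ i) (v ‼ (i + τ)) → ValidAt v τ i s
  checks⇒valid v τ i s record { starts = e₁ ; follows = e₂ ; ends = e₃ ; carries = e₄ ; increments = e₅ ; lastTop = e₆ }
    rewrite e₁ | e₂ | e₃ | e₄ | e₅ | e₆ = refl

  endsWithHash-hash : ∀ r → endsWithHash r hash ≡ true
  endsWithHash-hash nothing = refl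
  endsWithHash-hash (just _) = refl

  carryCorrect-hash : ∀ l → carryCorrect l hash ≡ true
  carryCorrect-hash nothing = refl
  carryCorrect-hash (just hash) = refl
  carryCorrect-hash (just (digit _ _)) = refl

  lastBlockTop-hash : ∀ R → lastBlockTop R hash ≡ true
  lastBlockTop-hash nothing = refl
  lastBlockTop-hash (just _) = refl

  lastBlockTop-top : ∀ R c → lastBlockTop R (digit top c) ≡ true
  lastBlockTop-top nothing c = isTop-top
  lastBlockTop-top (just _) c = refl

  incrementsPrevious-isHash : ∀ x l s → incrementsPrevious (just x) l s ≡ true → isHash s ≡ isHash x
  incrementsPrevious-isHash hash l s eq = eq
  incrementsPrevious-isHash (digit _ _) l (digit _ _) _ = refl

  module Structure (v : List Letter) (τ′ : ℕ) (valid : Valid v (suc τ′)) where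

    τ : ℕ
    τ = suc τ′

    n : ℕ
    n = length v

    open Checks

    checksAt : ∀ i {s} → v ‼ i ≡ just s → Checks s (back v 1 i) (v ‼ suc i) (back v τ i) (v ‼ (i + τ))
    checksAt i {s} v[i] = checks s _ _ _ _ (valid i s v[i])

    isHash-first-block : ∀ r {s} → r < τ → v ‼ r ≡ just s → isHash s ≡ (r ≡ᵇ 0)
    isHash-first-block zero _ v[0] = starts (checksAt 0 v[0])
    isHash-first-block (suc r) {hash} r<τ v[1+r] = ⊥-elim (just⇒¬is-nothing (proj₂ (<⇒‼-just v r r<n)) is-nothing-v[r])
      where
      r<n : r < n
      r<n = <-trans (n<1+n r) (‼-just⇒< v (suc r) v[1+r])
      is-nothing-v[r] : is-nothing (v ‼ r) ≡ true
      is-nothing-v[r] = subst (λ L → incrementsPrevious L (v ‼ r) hash ≡ true) (back-< v r<τ) (increments (checksAt (suc r) v[1+r]))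
    isHash-first-block (suc r) {digit _ _} r<τ v[1+r] = refl

    isHash-in-block : ∀ j r {s} → r < τ → v ‼ (r + j * τ) ≡ just s → isHash s ≡ (r ≡ᵇ 0)
    isHash-in-block zero r r<τ v[i] = isHash-first-block r r<τ (trans (cong (v ‼_) (sym (+-identityʳ r))) v[i])
    isHash-in-block (suc j) r {s} r<τ v[i] =
      trans (incrementsPrevious-isHash s′ _ s farLeft-valid) (isHash-in-block j r r<τ v[i-τ])
      where
      i-τ<n : r + j * τ < n
      i-τ<n = <-trans (m<n+m (r + j * τ) {τ} (s≤s z≤n)) (subst (_< n) (block-+ r j τ) (‼-just⇒< v _ v[i]))
      s′ = proj₁ (<⇒‼-just v _ i-τ<n)
      v[i-τ] = proj₂ (<⇒‼-just v _ i-τ<n)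
      farLeft-valid : incrementsPrevious (just s′) (back v 1 (r + suc j * τ)) s ≡ true
      farLeft-valid = subst (λ L → incrementsPrevious L (back v 1 (r + suc j * τ)) s ≡ true)
        (trans (cong (back v τ) (block-+ r j τ)) (trans (back-+ v τ (r + j * τ)) v[i-τ]))
        (increments (checksAt _ v[i]))

    block-length : ∀ j b → v ‼ (j * τ + suc b) ≡ just hash →
      (∀ p → p < b → ∃[ d ] ∃[ c ] (v ‼ (j * τ + suc p) ≡ just (digit d c))) → τ ≡ suc b
    block-length j b v[1+b] digits with <-cmp τ (suc b)
    ... | tri≈ _ τ≡1+b _ = τ≡1+b
    ... | tri> _ _ 1+b<τ
      with () ← isHash-in-block j (suc b) 1+b<τ (trans (cong (v ‼_) (+-comm (suc b) (j * τ))) v[1+b])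
    ... | tri< τ<1+b _ _ with _ , _ , v[τ] ← digits τ′ (≤-pred τ<1+b)
      with () ← isHash-in-block (suc j) 0 (s≤s z≤n) (trans (cong (v ‼_) (+-comm τ (j * τ))) v[τ])

    hash-at-0 : v ≢ [] → v ‼ 0 ≡ just hash
    hash-at-0 v≢[] = let (s , v[0]) = ≢[]⇒‼0 v v≢[] in
      trans v[0] (cong just (isHash⇒≡hash s (starts (checksAt 0 v[0]))))

    digit-at-1 : v ≢ [] → ∃[ d ] ∃[ c ] (v ‼ 1 ≡ just (digit d c))
    digit-at-1 v≢[] = followed-by-digit (v ‼ 1) (follows (checksAt 0 (hash-at-0 v≢[])))
      where
      followed-by-digit : ∀ r → hashFollowedByDigit nothing hash r ≡ true → ∃[ d ] ∃[ c ] (r ≡ just (digit d c))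
      followed-by-digit (just (digit d c)) _ = d , c , refl

    hash-at-end : ∀ n′ → n ≡ suc n′ → v ‼ n′ ≡ just hash
    hash-at-end n′ n≡ = let (s , v[n′]) = <⇒‼-just v n′ (subst (n′ <_) (sym n≡) ≤-refl) in
      trans v[n′] (cong just (isHash⇒≡hash s
        (subst (λ r → endsWithHash r s ≡ true) (≥⇒‼-nothing v (suc n′) (≤-reflexive n≡)) (ends (checksAt n′ v[n′])))))

    1≤τ′ : v ≢ [] → 1 ≤ τ′
    1≤τ′ v≢[] = n≢0⇒n>0 τ′≢0
      where
      τ′≢0 : τ′ ≢ 0
      τ′≢0 τ′≡0 with d , c , v[1] ← digit-at-1 v≢[]
        with () ← isHash-in-block 1 0 (s≤s z≤n) (subst (λ x → v ‼ suc (x + 0) ≡ just (digit d c)) (sym τ′≡0) v[1])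

    length≡blocks : v ≢ [] → ∃[ m ] (n ≡ suc (m * τ) × 1 ≤ m)
    length≡blocks v≢[] with n in n≡
    ... | zero with () ← subst (0 <_) n≡ (‼-just⇒< v 0 (proj₂ (≢[]⇒‼0 v v≢[])))
    ... | suc n′ = n′ / τ , cong suc n′≡ , n≢0⇒n>0 m≢0
      where
      n′≡r+mτ : n′ ≡ n′ % τ + n′ / τ * τ
      n′≡r+mτ = m≡m%n+[m/n]*n n′ τ
      r≡0 : n′ % τ ≡ 0
      r≡0 = ≡ᵇ-true⇒≡ (n′ % τ) 0 (sym (isHash-in-block (n′ / τ) (n′ % τ) (m%n<n n′ τ)
              (trans (cong (v ‼_) (sym n′≡r+mτ)) (hash-at-end n′ n≡))))
      n′≡ : n′ ≡ n′ / τ * τ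
      n′≡ = trans n′≡r+mτ (cong (_+ n′ / τ * τ) r≡0)
      m≢0 : n′ / τ ≢ 0
      m≢0 m≡0 = <-irrefl refl (subst (1 <_) (trans n≡ (cong suc (trans n′≡ (cong (_* τ) m≡0))))
                                     (‼-just⇒< v 1 (proj₂ (proj₂ (digit-at-1 v≢[])))))

    hash-at-block-start : ∀ j → j * τ < n → v ‼ (j * τ) ≡ just hash
    hash-at-block-start j jτ<n = let (s , v[jτ]) = <⇒‼-just v _ jτ<n in
      trans v[jτ] (cong just (isHash⇒≡hash s (isHash-in-block j 0 (s≤s z≤n) v[jτ])))

    module Rows (m′ : ℕ) (n≡ : n ≡ suc (suc m′ * τ)) where

      -- Digit p of block j and its carry tag; the defaults for non-digits are never used,
      -- since every such position holds a digit (letter-in-row).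
      digitOf : Maybe Letter → ℕ
      digitOf (just (digit d _)) = d
      digitOf _ = 0

      carryOf : Maybe Letter → Bool
      carryOf (just (digit _ c)) = c
      carryOf _ = false

      digitAt : ℕ → ℕ → ℕ
      digitAt j p = digitOf (v ‼ (suc p + j * τ))

      carryAt : ℕ → ℕ → Bool
      carryAt j p = carryOf (v ‼ (suc p + j * τ))

      in-range : ∀ j r → j ≤ m′ → r < τ → r + j * τ < n
      in-range j r j≤m′ r<τ = begin-strict
        r + j * τ          <⟨ +-monoˡ-< (j * τ) r<τ ⟩
        τ + j * τ          ≤⟨ *-monoˡ-≤ τ (s≤s j≤m′) ⟩
        suc m′ * τ         <⟨ n<1+n _ ⟩
        suc (suc m′ * τ)   ≡⟨ n≡ ⟨
        n                  ∎
        where open ≤-Reasoning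

      letter-in-row : ∀ j p → j ≤ m′ → p < τ′ → v ‼ (suc p + j * τ) ≡ just (digit (digitAt j p) (carryAt j p))
      letter-in-row j p j≤m′ p<τ′ with <⇒‼-just v _ (in-range j (suc p) j≤m′ (s≤s p<τ′))
      ... | s , v[i] with ¬isHash⇒digit s (isHash-in-block j (suc p) (s≤s p<τ′) v[i])
      ...   | d , c , refl rewrite v[i] = refl

      first-row : AllEqual (digitAt 0) τ′ 0
      first-row p p<τ′ = ≡ᵇ-true⇒≡ _ 0
        (subst (λ L → incrementsPrevious L (back v 1 (suc p + 0)) (digit (digitAt 0 p) (carryAt 0 p)) ≡ true)
               (back-< v (subst (_< τ) (sym (+-identityʳ (suc p))) (s≤s p<τ′)))
               (increments (checksAt _ (letter-in-row 0 p z≤n p<τ′))))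

      carryAt≡carry : ∀ j → j ≤ m′ → ∀ p → p < τ′ → carryAt j p ≡ carry (digitAt j) p
      carryAt≡carry j j≤m′ zero 0<τ′ =
        subst (λ l → carryCorrect l (digit (digitAt j 0) (carryAt j 0)) ≡ true)
              (hash-at-block-start j (in-range j 0 j≤m′ (s≤s z≤n)))
              (carries (checksAt _ (letter-in-row j 0 j≤m′ 0<τ′)))
      carryAt≡carry j j≤m′ (suc p) 1+p<τ′ = trans
        (==⇒≡ _ _ (subst (λ l → carryCorrect l (digit (digitAt j (suc p)) (carryAt j (suc p))) ≡ true)
                         (letter-in-row j p j≤m′ p<τ′)
                         (carries (checksAt _ (letter-in-row j (suc p) j≤m′ 1+p<τ′)))))
        (cong (_∧ isTop (digitAt j p)) (carryAt≡carry j j≤m′ p p<τ′))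
        where
        p<τ′ : p < τ′
        p<τ′ = <-trans (n<1+n p) 1+p<τ′

      next-row : ∀ j → j < m′ → Successor (digitAt j) (digitAt (suc j)) τ′
      next-row j j<m′ p p<τ′ = trans
        (≡ᵇ-true⇒≡ _ _ (subst (λ L → incrementsPrevious L (back v 1 i) (digit (digitAt (suc j) p) (carryAt (suc j) p)) ≡ true)
                             farLeft (increments (checksAt i (letter-in-row (suc j) p j<m′ p<τ′)))))
        (cong (bump (digitAt j p)) (carryAt≡carry j (<⇒≤ j<m′) p p<τ′))
        where
        i = suc p + suc j * τ
        farLeft : back v τ i ≡ just (digit (digitAt j p) (carryAt j p))
        farLeft = trans (cong (back v τ) (block-+ (suc p) j τ))
                        (trans (back-+ v τ (suc p + j * τ)) (letter-in-row j p (<⇒≤ j<m′) p<τ′))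

      last-row : AllEqual (digitAt m′) τ′ top
      last-row p p<τ′ = isTop⇒≡top _
        (subst (λ R → lastBlockTop R (digit (digitAt m′ p) (carryAt m′ p)) ≡ true)
               (≥⇒‼-nothing v (i + τ) n≤i+τ)
               (lastTop (checksAt i (letter-in-row m′ p ≤-refl p<τ′))))
        where
        i = suc p + m′ * τ
        n≤i+τ : n ≤ i + τ
        n≤i+τ = begin
          n                  ≡⟨ n≡ ⟩
          suc (τ + m′ * τ)   ≡⟨ cong suc (+-comm τ (m′ * τ)) ⟩
          suc (m′ * τ + τ)   ≤⟨ s≤s (+-monoˡ-≤ τ (m≤n+m (m′ * τ) p)) ⟩
          i + τ              ∎
          where open ≤-Reasoning

      count-blocks : B ^ τ′ ≤ suc m′
      count-blocks = count-length τ′ m′ digitAt first-row next-row last-row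

    valid-length : v ≢ [] → 1 ≤ τ′ × B ^ τ′ ≤ n
    valid-length v≢[] with length≡blocks v≢[]
    ... | suc m′ , n≡ , _ = 1≤τ′ v≢[] , (begin
      B ^ τ′             ≤⟨ Rows.count-blocks m′ n≡ ⟩
      suc m′             ≤⟨ m≤m*n (suc m′) τ ⟩
      suc m′ * τ         <⟨ n<1+n _ ⟩
      suc (suc m′ * τ)   ≡⟨ n≡ ⟨
      n                  ∎)
      where open ≤-Reasoning

  module CounterWord (ℓ : ℕ) (1≤ℓ : 1 ≤ ℓ) where

    τ : ℕ
    τ = suc ℓ

    m : ℕ
    m = B ^ ℓ

    n : ℕ
    n = suc (m * τ)

    letterAt : ℕ → ℕ → Letter
    letterAt j zero = hash
    letterAt j (suc p) = digit (count j p) (carry (count j) p)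

    codeAt : ℕ → ℕ → Fin k
    codeAt j zero = zero
    codeAt j (suc p) = encodeDigit (count j p) (count-< j p) (carry (count j) p)

    decode-codeAt : ∀ j r → decode (codeAt j r) ≡ letterAt j r
    decode-codeAt j zero = refl
    decode-codeAt j (suc p) = decode-encodeDigit (count j p) (count-< j p) (carry (count j) p)

    code : ℕ → Fin k
    code i = codeAt (i / τ) (i % τ)

    word : List (Fin k)
    word = applyUpTo code n

    letters : List Letter
    letters = map decode word

    length-letters : length letters ≡ n
    length-letters = trans (length-map decode word) (length-applyUpTo code n)

    letters-at : ∀ j r → r < τ → r + j * τ < n → letters ‼ (r + j * τ) ≡ just (letterAt j r)
    letters-at j r r<τ i<n = begin
      letters ‼ (r + j * τ)                                        ≡⟨ ‼-map decode word (r + j * τ) ⟩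
      Maybe.map decode (word ‼ (r + j * τ))                         ≡⟨ cong (Maybe.map decode) (‼-applyUpTo code n (r + j * τ) i<n) ⟩
      just (decode (codeAt ((r + j * τ) / τ) ((r + j * τ) % τ)))     ≡⟨ cong₂ (λ j r → just (decode (codeAt j r))) (/-block r j τ r<τ) (%-block r j τ r<τ) ⟩
      just (decode (codeAt j r))                                    ≡⟨ cong just (decode-codeAt j r) ⟩
      just (letterAt j r)                                           ∎
      where open ≡-Reasoning

    letters-beyond : ∀ i → n ≤ i → letters ‼ i ≡ nothing
    letters-beyond i n≤i = ≥⇒‼-nothing letters i (subst (_≤ i) (sym length-letters) n≤i)

    letter-exists : ∀ i → i < n → ∃[ s ] (letters ‼ i ≡ just s)
    letter-exists i i<n = <⇒‼-just letters i (subst (i <_) (sym length-letters) i<n)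

    2≤m : 2 ≤ m
    2≤m = ≤-trans 2≤B (≤-trans (≤-reflexive (sym (*-identityʳ B))) (^-monoʳ-≤ B {{ℕ.>-nonZero (≤-trans (s≤s z≤n) 2≤B)}} 1≤ℓ))

    τ+τ<n : τ + τ < n
    τ+τ<n = s≤s (≤-trans (≤-reflexive (cong (λ x → τ + x) (sym (+-identityʳ τ)))) (*-monoˡ-≤ τ 2≤m))

    block<m : ∀ j p → suc p + j * τ < n → j < m
    block<m j p i<n = *-cancelʳ-< τ j m (≤-trans (s≤s (m≤n+m (j * τ) p)) (≤-pred i<n))

    valid-start : ValidAt letters τ 0 hash
    valid-start = checks⇒valid letters τ 0 hash record
      { starts = refl
      ; follows = subst (λ r → hashFollowedByDigit nothing hash r ≡ true)
                        (sym (letters-at 0 1 (s≤s 1≤ℓ) (<-≤-trans (s≤s (s≤s z≤n)) τ+τ<n))) refl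
      ; ends = endsWithHash-hash (letters ‼ 1)
      ; carries = refl
      ; increments = refl
      ; lastTop = lastBlockTop-hash (letters ‼ τ)
      }

    valid-block-start : ∀ j → suc j * τ < n → ValidAt letters τ (suc j * τ) hash
    valid-block-start j i<n = checks⇒valid letters τ (suc j * τ) hash record
      { starts = subst (λ l → startsWithHash l hash ≡ true) (sym left) refl
      ; follows = follows
      ; ends = endsWithHash-hash (letters ‼ suc i)
      ; carries = carryCorrect-hash (back letters 1 i)
      ; increments = subst (λ L → incrementsPrevious L (back letters 1 i) hash ≡ true)
          (sym (trans (back-+ letters τ (j * τ)) (letters-at j 0 (s≤s z≤n) (<-trans (m<n+m (j * τ) (s≤s z≤n)) i<n)))) refl
      ; lastTop = lastBlockTop-hash (letters ‼ (i + τ))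
      }
      where
      i = suc j * τ
      left : back letters 1 i ≡ just (proj₁ (letter-exists (ℓ + j * τ) (<-trans (n<1+n _) i<n)))
      left = proj₂ (letter-exists (ℓ + j * τ) (<-trans (n<1+n _) i<n))
      follows : hashFollowedByDigit (back letters 1 i) hash (letters ‼ suc i) ≡ true
      follows rewrite left with suc i <? n
      ... | yes 1+i<n rewrite letters-at (suc j) 1 (s≤s 1≤ℓ) 1+i<n = refl
      ... | no 1+i≮n rewrite letters-beyond (suc i) (≮⇒≥ 1+i≮n) = refl

    valid-digit : ∀ j p → p < ℓ → suc p + j * τ < n → ValidAt letters τ (suc p + j * τ) (letterAt j (suc p))
    valid-digit j p p<ℓ i<n = checks⇒valid letters τ i (letterAt j (suc p)) record
      { starts = subst (λ l → startsWithHash l (letterAt j (suc p)) ≡ true) (sym left) refl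
      ; follows = refl
      ; ends = subst (λ r → endsWithHash r (letterAt j (suc p)) ≡ true) (sym (proj₂ right)) refl
      ; carries = subst (λ l → carryCorrect l (letterAt j (suc p)) ≡ true) (sym left) (carry-ok p)
      ; increments = increments j i<n
      ; lastTop = lastTop
      }
      where
      i = suc p + j * τ
      j<m : j < m
      j<m = block<m j p i<n
      left : back letters 1 i ≡ just (letterAt j p)
      left = letters-at j p (<-trans p<ℓ (n<1+n ℓ)) (<-trans (n<1+n _) i<n)
      right : ∃[ s ] (letters ‼ suc i ≡ just s)
      right = letter-exists (suc i) (s≤s (≤-trans (+-monoˡ-≤ (j * τ) (s≤s p<ℓ)) (*-monoˡ-≤ τ j<m)))
      carry-ok : ∀ p → carryCorrect (just (letterAt j p)) (letterAt j (suc p)) ≡ true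
      carry-ok zero = refl
      carry-ok (suc p) = ==-refl (carry (count j) (suc p))
      increments : ∀ j → suc p + j * τ < n →
        incrementsPrevious (back letters τ (suc p + j * τ)) (back letters 1 (suc p + j * τ)) (letterAt j (suc p)) ≡ true
      increments zero _ = subst (λ L → incrementsPrevious L (back letters 1 (suc p + 0)) (letterAt 0 (suc p)) ≡ true)
        (sym (back-< letters (subst (_< τ) (sym (+-identityʳ (suc p))) (s≤s p<ℓ)))) refl
      increments (suc j) i<n = subst (λ L → incrementsPrevious L (back letters 1 (suc p + suc j * τ)) (letterAt (suc j) (suc p)) ≡ true)
        (sym (trans (cong (back letters τ) (block-+ (suc p) j τ))
                    (trans (back-+ letters τ (suc p + j * τ))
                           (letters-at j (suc p) (s≤s p<ℓ) (<-trans (m<n+m _ {τ} (s≤s z≤n)) (subst (_< n) (block-+ (suc p) j τ) i<n))))))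
        (≡ᵇ-refl (count (suc j) p))
      lastTop : lastBlockTop (letters ‼ (i + τ)) (letterAt j (suc p)) ≡ true
      lastTop with suc j <? m
      ... | yes 1+j<m = subst (λ R → lastBlockTop R (letterAt j (suc p)) ≡ true) (sym (proj₂ farRight)) refl
        where
        farRight : ∃[ s ] (letters ‼ (i + τ) ≡ just s)
        farRight = letter-exists (i + τ) (subst (_< n) (trans (block-+ (suc p) j τ) (+-comm τ i))
                     (s≤s (≤-trans (+-monoˡ-≤ (suc j * τ) (s≤s (<⇒≤ p<ℓ))) (*-monoˡ-≤ τ 1+j<m))))
      ... | no 1+j≮m rewrite carry⇒tops (count j) ℓ (carry-count-last ℓ j (≤-antisym j<m (≮⇒≥ 1+j≮m))) p p<ℓ
        = lastBlockTop-top (letters ‼ (i + τ)) (carry (count j) p)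

    letters-valid : Valid letters τ
    letters-valid i s letters[i] = subst₂ (ValidAt letters τ) (sym i≡) (just-injective (trans (sym letters-at-i) letters[i])) valid-at-i
      where
      r = i % τ
      j = i / τ
      i≡ : i ≡ r + j * τ
      i≡ = m≡m%n+[m/n]*n i τ
      i<n : r + j * τ < n
      i<n = subst (_< n) i≡ (subst (i <_) length-letters (‼-just⇒< letters i letters[i]))
      letters-at-i : letters ‼ i ≡ just (letterAt j r)
      letters-at-i = trans (cong (letters ‼_) i≡) (letters-at j r (m%n<n i τ) i<n)
      valid-at : ∀ r → r < τ → r + j * τ < n → ValidAt letters τ (r + j * τ) (letterAt j r)
      valid-at zero _ i<n with j
      ... | zero = valid-start
      ... | suc j′ = valid-block-start j′ i<n
      valid-at (suc p) (s≤s p<ℓ) i<n = valid-digit j p p<ℓ i<n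
      valid-at-i : ValidAt letters τ (r + j * τ) (letterAt j r)
      valid-at-i = valid-at r (m%n<n i τ) i<n

    hash-at-block : ∀ j → j ≤ 2 → letters ‼ (j * τ) ≡ just hash
    hash-at-block j j≤2 = letters-at j 0 (s≤s z≤n) (s≤s (*-monoˡ-≤ τ (≤-trans j≤2 2≤m)))

    digit-in-block : ∀ j p → j ≤ 1 → p < ℓ → ∃[ d ] ∃[ c ] (letters ‼ (j * τ + suc p) ≡ just (digit d c))
    digit-in-block j p j≤1 p<ℓ = count j p , carry (count j) p ,
      trans (cong (letters ‼_) (+-comm (j * τ) (suc p))) (letters-at j (suc p) (s≤s p<ℓ) (<-≤-trans i<2τ (<⇒≤ τ+τ<n)))
      where
      i<2τ : suc p + j * τ < τ + τ
      i<2τ = +-mono-<-≤ (s≤s p<ℓ) (≤-trans (*-monoˡ-≤ τ j≤1) (≤-reflexive (+-identityʳ τ)))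

  accepted⇒valid : ∀ w → LangACA counterACA w → ∃[ τ′ ] (AcceptsAt counterACA w (suc τ′) × Valid (map decode w) (suc τ′))
  accepted⇒valid w (w≢[] , zero , acc) = ⊥-elim (Run.¬accepts-at-0 w w≢[] acc)
  accepted⇒valid w (w≢[] , suc τ′ , acc) = τ′ , acc , Equivalence.to (Run.accepts⇔valid w τ′) acc

  module Splice (a b : ℕ) where
    module A = CounterWord (suc a) (s≤s z≤n)
    module W = CounterWord (suc b) (s≤s z≤n)

    spliced : List (Fin k)
    spliced = take (suc (suc a)) A.word ++ drop (suc (suc b)) W.word

    prefix suffix : List Letter
    prefix = take A.τ A.letters
    suffix = drop W.τ W.letters

    letters-spliced : map decode spliced ≡ prefix ++ suffix
    letters-spliced = trans (map-++ decode (take A.τ A.word) (drop W.τ W.word))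
                            (cong₂ _++_ (sym (take-map A.τ A.word)) (sym (drop-map W.τ W.word)))

    length-prefix : length prefix ≡ A.τ
    length-prefix = trans (length-take A.τ A.letters)
      (m≤n⇒m⊓n≡m (subst (A.τ ≤_) (sym A.length-letters) (<⇒≤ (<-trans (m<m+n A.τ (s≤s z≤n)) A.τ+τ<n))))

    at-prefix : ∀ x → x < A.τ → (prefix ++ suffix) ‼ x ≡ A.letters ‼ x
    at-prefix x x<τ = trans (‼-++ˡ prefix suffix x (subst (x <_) (sym length-prefix) x<τ)) (‼-take A.τ A.letters x x<τ)

    at-suffix : ∀ x → (prefix ++ suffix) ‼ (A.τ + x) ≡ W.letters ‼ (W.τ + x)
    at-suffix x = trans (cong (λ y → (prefix ++ suffix) ‼ (y + x)) (sym length-prefix))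
                        (trans (‼-++ʳ prefix suffix x) (‼-drop W.τ W.letters x))

    period-of-spliced : ∀ τ′ → Valid (prefix ++ suffix) (suc τ′) → suc τ′ ≡ A.τ × suc τ′ ≡ W.τ
    period-of-spliced τ′ valid = τ≡τA , τ≡τW
      where
      open Structure (prefix ++ suffix) τ′ valid using (block-length)
      X = prefix ++ suffix
      τ≡τA : suc τ′ ≡ A.τ
      τ≡τA = block-length 0 (suc a)
        (trans (cong (X ‼_) (sym (+-identityʳ A.τ))) (trans (at-suffix 0) (W.hash-at-block 1 (s≤s z≤n))))
        (λ p p<1+a → let (d , c , A[p]) = A.digit-in-block 0 p z≤n p<1+a in
          d , c , trans (at-prefix (suc p) (s≤s p<1+a)) A[p])
      1*τ≡τA : 1 * suc τ′ ≡ A.τ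
      1*τ≡τA = trans (+-identityʳ (suc τ′)) τ≡τA
      at-second-block : ∀ x → X ‼ (1 * suc τ′ + x) ≡ W.letters ‼ (1 * W.τ + x)
      at-second-block x = trans (cong (λ y → X ‼ (y + x)) 1*τ≡τA)
                         (trans (at-suffix x) (cong (λ y → W.letters ‼ (y + x)) (sym (+-identityʳ W.τ))))
      τ≡τW : suc τ′ ≡ W.τ
      τ≡τW = block-length 1 (suc b)
        (trans (at-second-block W.τ) (trans (cong (W.letters ‼_) (+-comm (1 * W.τ) W.τ)) (W.hash-at-block 2 ≤-refl)))
        (λ p p<1+b → let (d , c , W[p]) = W.digit-in-block 1 p ≤-refl p<1+b in d , c , trans (at-second-block (suc p)) W[p])

  spliced-accepted⇒≡ : ∀ a b → LangACA counterACA (Splice.spliced a b) → a ≡ b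
  spliced-accepted⇒≡ a b accepted with accepted⇒valid _ accepted
  ... | τ′ , _ , valid with period-of-spliced τ′ (subst (λ v → Valid v (suc τ′)) letters-spliced valid)
    where open Splice a b
  ...   | τ≡τA , τ≡τW = suc-injective (suc-injective (trans (sym τ≡τA) τ≡τW))

  counterWord-accepted : ∀ ℓ → LangACA counterACA (CounterWord.word (suc ℓ) (s≤s z≤n))
  counterWord-accepted ℓ = (λ ()) , suc (suc ℓ) , Equivalence.from (Run.accepts⇔valid word (suc ℓ)) letters-valid
    where open CounterWord (suc ℓ) (s≤s z≤n)

  counter-nonregular : ¬ InREG (LangACA counterACA)
  counter-nonregular (D , L≐D) with pigeonhole (n<1+n (DFA.nS D)) (λ x → state (toℕ x))
    where
    state : ℕ → Fin (DFA.nS D)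
    state a = run D (DFA.start D) (take (suc (suc a)) (CounterWord.word (suc a) (s≤s z≤n)))
  ... | x , y , x<y , same-state = <-irrefl (spliced-accepted⇒≡ (toℕ x) (toℕ y) spliced-accepted) x<y
    where
    open Splice (toℕ x) (toℕ y)
    s₀ = DFA.start D
    spliced-run : run D s₀ spliced ≡ run D s₀ W.word
    spliced-run = begin
      run D s₀ spliced                                        ≡⟨ run-++ D s₀ (take A.τ A.word) (drop W.τ W.word) ⟩
      run D (run D s₀ (take A.τ A.word)) (drop W.τ W.word)    ≡⟨ cong (λ s → run D s (drop W.τ W.word)) same-state ⟩
      run D (run D s₀ (take W.τ W.word)) (drop W.τ W.word)    ≡⟨ run-++ D s₀ (take W.τ W.word) (drop W.τ W.word) ⟨
      run D s₀ (take W.τ W.word ++ drop W.τ W.word)           ≡⟨ cong (run D s₀) (take++drop≡id W.τ W.word) ⟩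
      run D s₀ W.word                                         ∎
      where open ≡-Reasoning
    spliced-accepted : LangACA counterACA spliced
    spliced-accepted = Equivalence.from (L≐D spliced)
      ((λ ()) , trans (cong (DFA.final D) spliced-run) (proj₂ (Equivalence.to (L≐D W.word) (counterWord-accepted (toℕ y)))))

  accepted-length : ∀ w → LangACA counterACA w → ∃[ τ′ ] (AcceptsAt counterACA w (suc τ′) × 1 ≤ τ′ × B ^ τ′ ≤ length w)
  accepted-length w accepted@(w≢[] , _) with accepted⇒valid w accepted
  ... | τ′ , acc , valid with Structure.valid-length (map decode w) τ′ valid (map-≢[] w w≢[])
    where
    map-≢[] : ∀ w → w ≢ [] → map decode w ≢ []
    map-≢[] [] w≢[] = ⊥-elim (w≢[] refl)
    map-≢[] (_ ∷ _) _ ()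
  ... | 1≤τ′ , B^τ′≤n = τ′ , acc , 1≤τ′ , subst (B ^ τ′ ≤_) (length-map decode w) B^τ′≤n

-- ACA(t) ⊄ REG for t ∈ Ω(log n)

n<2^n : ∀ n → n < 2 ^ n
n<2^n zero = s≤s z≤n
n<2^n (suc n) = subst (_< 2 ^ suc n) (+-comm n 1) (+-mono-<-≤ (n<2^n n) (≤-trans (m^n>0 2 n) (m≤m+n (2 ^ n) 0)))

exponential-length⇒time : ∀ (t : ℕ → ℕ) c N → (∀ n → N ≤ n → ⌊log₂ n ⌋ ≤ c * t n) →
  ∀ τ′ n → 1 ≤ τ′ → 2 ^ (suc (c + N) * τ′) ≤ n → suc τ′ ≤ t n
exponential-length⇒time t c N log≤ct τ′ n 1≤τ′ 2^eτ′≤n with suc τ′ ≤? t n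
... | yes 1+τ′≤t = 1+τ′≤t
... | no 1+τ′≰t = ⊥-elim (<-irrefl refl (begin-strict
    c * τ′      <⟨ *-monoˡ-< τ′ (s≤s (m≤m+n c N)) ⟩
    e * τ′      ≡⟨ ⌊log₂[2^n]⌋≡n (e * τ′) ⟨
    ⌊log₂ 2 ^ (e * τ′) ⌋   ≤⟨ ⌊log₂⌋-mono-≤ 2^eτ′≤n ⟩
    ⌊log₂ n ⌋   ≤⟨ log≤ct n N≤n ⟩
    c * t n     ≤⟨ *-monoʳ-≤ c (≮⇒≥ 1+τ′≰t) ⟩
    c * τ′      ∎))
  where
  open ≤-Reasoning
  instance
    τ′≢0 : ℕ.NonZero τ′
    τ′≢0 = ℕ.>-nonZero 1≤τ′
  e = suc (c + N)
  N≤n : N ≤ n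
  N≤n = ≤-trans (m≤n+m N c) (≤-trans (n≤1+n _) (≤-trans (m≤m*n e τ′) (≤-trans (<⇒≤ (n<2^n (e * τ′))) 2^eτ′≤n)))

ACA⊄REG : ∀ t → IsΩlog t → ¬ ACA⊆REG t
ACA⊄REG t (c , N , log≤ct) ACA⊆REG =
  counter-nonregular (ACA⊆REG k (LangACA counterACA) (counterACA , (λ _ → mk⇔ id id) , fast))
  where
  e = suc (c + N)
  B = 2 ^ e
  2≤B : 2 ≤ B
  2≤B = *-monoʳ-≤ 2 (m^n>0 2 (c + N))
  open CounterLanguage B 2≤B using (k; counterACA; counter-nonregular; accepted-length)
  fast : ∀ w → LangACA counterACA w → AcceptsWithin counterACA (t (length w)) w
  fast w accepted with accepted-length w accepted
  ... | τ′ , acc , 1≤τ′ , B^τ′≤n =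
    suc τ′ , exponential-length⇒time t c N log≤ct τ′ (length w) 1≤τ′ (subst (_≤ length w) (^-*-assoc 2 e τ′) B^τ′≤n) , acc

proposition2 : (t : ℕ → ℕ) → IsΩlog t → Is-o-n t → (¬ ACA⊆REG t) × (¬ REG⊆ACA t)
proposition2 t t∈Ω[log] t∈o[n] = ACA⊄REG t t∈Ω[log] , REG⊄ACA t t∈o[n]
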